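{- Let $t$ be a positive integer. There is an integer $f(t)$ such that if the block-cutvertex tree $T$ of a graph $G$ contains a path of order $f(t)$, then $G$ contains an induced subgraph that is a chain of at least $t$ blocks.
   Context: Graphs are finite and simple. A block is a maximal connected subgraph without a cutvertex. The block-cutvertex tree of $G$ has a vertex for each cutvertex and for each block of $G$, a cutvertex being adjacent to the blocks containing it. A chain of $n$ blocks is a graph with exactly $n$ blocks whose block-cutvertex tree is a path. -}

module Defs where

open import Data.Nat using (ℕ; zero; suc; _+_; _≥_)
open import Data.Fin using (Fin; toℕ)
import Data.Fin as F
open import Data.Fin.Subset using (Subset; _∈_; _⊆_; ⊤)
open import Data.Bool using (Bool; true; false)
open import Data.Sum using (_⊎_; inj₁; inj₂)
open import Data.Product using (Σ; _×_; ∃; ∃-syntax)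
open import Data.Empty using (⊥)
open import Data.Unit using () renaming (⊤ to Unit)
open import Relation.Nullary using (¬_)
open import Relation.Binary.PropositionalEquality using (_≡_; _≢_)
open import Function using (_∘_)

record Graph (n : ℕ) : Set where
  field
    adj    : Fin n → Fin n → Bool
    sym    : ∀ i j → adj i j ≡ adj j i
    irrefl : ∀ i → adj i i ≡ false
open Graph public

module _ {n : ℕ} (G : Graph n) where

  data Walk (P : Fin n → Set) : Fin n → Fin n → Set where
    here : ∀ {u} → P u → Walk P u u
    step : ∀ {u v w} → P u → adj G u v ≡ true → Walk P v w → Walk P u w

  Connected : Subset n → Set
  Connected S = (∃[ x ] x ∈ S) × (∀ u w → u ∈ S → w ∈ S → Walk (_∈ S) u w)

  -- v is a cutvertex of G[S]: its deletion increases the number of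
  -- components, i.e. it separates two vertices of one component of G[S].
  CutvertexIn : Subset n → Fin n → Set
  CutvertexIn S v = v ∈ S × (∃[ u ] ∃[ w ]
    (u ∈ S × w ∈ S × u ≢ v × w ≢ v × Walk (_∈ S) u w ×
     ¬ Walk (λ x → x ∈ S × x ≢ v) u w))

  IsCutvertex : Fin n → Set
  IsCutvertex = CutvertexIn ⊤

  NoCutvertex : Subset n → Set
  NoCutvertex S = ∀ v → ¬ CutvertexIn S v

  IsBlock : Subset n → Set
  IsBlock B = Connected B × NoCutvertex B ×
    (∀ B' → B ⊆ B' → Connected B' → NoCutvertex B' → B' ≡ B)

BCNode : ℕ → Set
BCNode n = Fin n ⊎ Subset n

ValidNode : ∀ {n} → Graph n → BCNode n → Set
ValidNode G (inj₁ v) = IsCutvertex G v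
ValidNode G (inj₂ B) = IsBlock G B

BCAdj : ∀ {n} → BCNode n → BCNode n → Set
BCAdj (inj₁ v) (inj₂ B) = v ∈ B
BCAdj (inj₂ B) (inj₁ v) = v ∈ B
BCAdj _ _ = ⊥

record BCPath {n : ℕ} (G : Graph n) (k : ℕ) : Set where
  field
    node     : Fin k → BCNode n
    valid    : ∀ i → ValidNode G (node i)
    distinct : ∀ i j → node i ≡ node j → i ≡ j
    consec   : ∀ i j → toℕ j ≡ suc (toℕ i) → BCAdj (node i) (node j)
open BCPath public

countBlocks : ∀ {n k} → (Fin k → BCNode n) → ℕ
countBlocks {k = zero}  f = 0
countBlocks {k = suc k} f with f F.zero
... | inj₁ _ = countBlocks (f ∘ F.suc)
... | inj₂ _ = suc (countBlocks (f ∘ F.suc))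

-- G is a chain of m blocks: its block-cutvertex tree is a path
-- (spanning path whose consecutive pairs are exactly its edges),
-- and G has exactly m blocks.
ChainOfBlocks : ∀ {n} → Graph n → ℕ → Set
ChainOfBlocks {n} G m = ∃[ k ] Σ (BCPath G k) λ P →
  (∀ x → ValidNode G x → ∃[ i ] node P i ≡ x) ×
  (∀ i j → BCAdj (node P i) (node P j) →
     toℕ j ≡ suc (toℕ i) ⊎ toℕ i ≡ suc (toℕ j)) ×
  countBlocks (node P) ≡ m

InducedSubgraph : ∀ {k n} → Graph k → Graph n → Set
InducedSubgraph {k} {n} H G = Σ (Fin k → Fin n) λ e →
  (∀ i j → e i ≡ e j → i ≡ j) × (∀ i j → adj H i j ≡ adj G (e i) (e j))

{-# OPTIONS --safe #-}
module Submission where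

-- A path of order 2t+2 in the block-cutvertex tree contains an alternating run
-- c_0 B_0 c_1 B_1 … B_{t-1} c_t of distinct cutvertices and blocks, with c_j, c_{j+1} ∈ B_j.
-- Every walk from c_0 to c_t passes through every c_i: otherwise, extended along the run, it
-- would join B_{i-1} to B_i while avoiding their common vertex c_i, and the union of the two
-- blocks with an induced such path would be connected without a cutvertex, against the
-- maximality of the blocks.  Shortcutting a c_0–c_t walk to an induced path hence leaves at
-- least t+1 vertices, and a path with L ≥ 1 edges is a chain of L blocks, namely its edges.
-- So f(t) = 2t+2 works.

open import Defs hiding (sym)
open import Data.Bool using (Bool; true; false)
open import Data.Bool.Properties using (¬-not)
open import Data.Empty using (⊥; ⊥-elim)
open import Data.Fin using (Fin; zero; suc; toℕ; inject₁; fromℕ<)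
open import Data.Fin.Subset using (Subset; _∈_; _⊆_; ⊤; ⁅_⁆; _∪_) renaming (⊥ to ∅)
open import Data.Fin.Subset.Properties
  using (_∈?_; x∈p∪q⁺; x∈p∪q⁻; x∈⁅x⁆; x∈⁅y⁆⇒x≡y; ∉⊥; ∈⊤; ⊆-antisym)
open import Data.List using (List; []; _∷_; length; lookup)
open import Data.List.Membership.Propositional using () renaming (_∈_ to _∈ₗ_)
open import Data.List.Membership.Propositional.Properties using (∈-lookup)
open import Data.List.Relation.Unary.All as All using (All; []; _∷_)
open import Data.List.Relation.Unary.All.Properties using (¬Any⇒All¬)
open import Data.List.Relation.Unary.Any as Any using (Any; here; there)
open import Data.List.Relation.Unary.Any.Properties using (lookup-index)
open import Data.Nat using (ℕ; zero; suc; _≤_; _<_; _≥_; z≤n; s≤s; _≡ᵇ_; _<?_)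
open import Data.Nat.Properties
  using (≤-refl; ≤-reflexive; ≤-trans; ≤-antisym; <-trans; <⇒≤; <⇒≢; <-asym; <-cmp; ≤-pred;
         n≤1+n; n<1+n; m<n⇒m<1+n; 1+n≰n; n≤0⇒n≡0; ≮⇒≥; ≤∧≢⇒<; m≤n⇒m<n∨m≡n; suc-injective)
open import Data.Product using (Σ; _×_; ∃-syntax; _,_; proj₁; proj₂; map₁; map₂)
open import Data.Sum using (_⊎_; inj₁; inj₂; [_,_]′)
open import Data.Sum.Properties using (inj₁-injective; inj₂-injective)
open import Data.Unit using (tt) renaming (⊤ to Unit)
open import Function using (_∘_)
open import Relation.Binary.Definitions using (tri<; tri≈; tri>)
open import Relation.Binary.PropositionalEquality
  using (_≡_; _≢_; refl; sym; trans; cong; cong₂; subst; subst₂)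
open import Relation.Nullary using (¬_; Dec; yes; no)
open import Relation.Nullary.Decidable using (_⊎-dec_; _×-dec_)
open import Relation.Nullary.Negation using (¬¬-map)
open import Relation.Unary using (Decidable)

import Data.Bool as Bool
import Data.Fin.Properties as Fin
import Data.Sum as Sum

private
  variable
    i j k m n : ℕ
    x y z : Fin n

double : ℕ → ℕ
double zero    = zero
double (suc j) = suc (suc (double j))

double-mono-≤ : i ≤ j → double i ≤ double j
double-mono-≤ z≤n       = z≤n
double-mono-≤ (s≤s i≤j) = s≤s (s≤s (double-mono-≤ i≤j))

double-cancel-≤ : double i ≤ double j → i ≤ j
double-cancel-≤ {zero}          _              = z≤n
double-cancel-≤ {suc i} {suc j} (s≤s (s≤s le)) = s≤s (double-cancel-≤ le)

odd<double⇒< : suc (double i) ≤ double j → i < j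
odd<double⇒< {zero}  {suc j} _              = s≤s z≤n
odd<double⇒< {suc i} {suc j} (s≤s (s≤s le)) = s≤s (odd<double⇒< le)

double-injective : double i ≡ double j → i ≡ j
double-injective {zero}  {zero}  _ = refl
double-injective {suc i} {suc j} e = cong suc (double-injective (suc-injective (suc-injective e)))

data Parity : ℕ → Set where
  even : ∀ j → Parity (double j)
  odd  : ∀ j → Parity (suc (double j))

parity-suc : Parity i → Parity (suc i)
parity-suc (even j) = odd j
parity-suc (odd j)  = even (suc j)

parity : ∀ i → Parity i
parity zero    = even zero
parity (suc i) = parity-suc (parity i)

parity-even : ∀ j → parity (double j) ≡ even j
parity-even zero = refl
parity-even (suc j) rewrite parity-even j = refl

parity-odd : ∀ j → parity (suc (double j)) ≡ odd j
parity-odd j = cong parity-suc (parity-even j)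

clamp : ℕ → Fin (suc m)
clamp         zero    = zero
clamp {zero}  (suc i) = zero
clamp {suc m} (suc i) = suc (clamp i)

toℕ-clamp : i ≤ m → toℕ (clamp {m} i) ≡ i
toℕ-clamp {zero}  _         = refl
toℕ-clamp {suc i} (s≤s i≤m) = cong suc (toℕ-clamp i≤m)

clamp-toℕ : (x : Fin (suc m)) → clamp (toℕ x) ≡ x
clamp-toℕ x = Fin.toℕ-injective (toℕ-clamp (Fin.toℕ≤pred[n] x))

clamp-injective : i ≤ m → j ≤ m → clamp {m} i ≡ clamp j → i ≡ j
clamp-injective i≤m j≤m e = trans (sym (toℕ-clamp i≤m)) (trans (cong toℕ e) (toℕ-clamp j≤m))

toℕ≡⇒≡clamp : {z : Fin (suc m)} → toℕ z ≡ k → z ≡ clamp k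
toℕ≡⇒≡clamp {z = z} e = trans (sym (clamp-toℕ z)) (cong clamp e)

injective-into-list : {A : Set} (f : Fin k → A) {xs : List A} →
                      (∀ {i j} → f i ≡ f j → i ≡ j) → (∀ i → f i ∈ₗ xs) → k ≤ length xs
injective-into-list f {xs} f-injective f∈xs = Fin.injective⇒≤ index-injective
  where
    index-injective : ∀ {i j} → Any.index (f∈xs i) ≡ Any.index (f∈xs j) → i ≡ j
    index-injective {i} {j} e = f-injective (trans (lookup-index (f∈xs i))
                                  (trans (cong (lookup xs) e) (sym (lookup-index (f∈xs j)))))

fromList : List (Fin n) → Subset n
fromList []       = ∅
fromList (x ∷ xs) = ⁅ x ⁆ ∪ fromList xs

∈-fromList⁺ : ∀ {xs} → z ∈ₗ xs → z ∈ fromList xs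
∈-fromList⁺ (here refl)  = x∈p∪q⁺ (inj₁ (x∈⁅x⁆ _))
∈-fromList⁺ (there z∈xs) = x∈p∪q⁺ (inj₂ (∈-fromList⁺ z∈xs))

∈-fromList⁻ : ∀ xs → z ∈ fromList xs → z ∈ₗ xs
∈-fromList⁻ []       z∈∅ = ⊥-elim (∉⊥ z∈∅)
∈-fromList⁻ (x ∷ xs) z∈  with x∈p∪q⁻ ⁅ x ⁆ (fromList xs) z∈
... | inj₁ z∈⁅x⁆ = here (x∈⁅y⁆⇒x≡y x z∈⁅x⁆)
... | inj₂ z∈xs  = there (∈-fromList⁻ xs z∈xs)

x∈pair : x ∈ ⁅ x ⁆ ∪ ⁅ y ⁆
x∈pair = x∈p∪q⁺ (inj₁ (x∈⁅x⁆ _))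

y∈pair : y ∈ ⁅ x ⁆ ∪ ⁅ y ⁆
y∈pair = x∈p∪q⁺ (inj₂ (x∈⁅x⁆ _))

∈pair⁻ : z ∈ ⁅ x ⁆ ∪ ⁅ y ⁆ → z ≡ x ⊎ z ≡ y
∈pair⁻ {x = x} {y = y} z∈ = Sum.map (x∈⁅y⁆⇒x≡y x) (x∈⁅y⁆⇒x≡y y) (x∈p∪q⁻ ⁅ x ⁆ ⁅ y ⁆ z∈)

pair⊆ : {S : Subset n} {x y : Fin n} → x ∈ S → y ∈ S → ⁅ x ⁆ ∪ ⁅ y ⁆ ⊆ S
pair⊆ {S = S} x∈S y∈S z∈ with ∈pair⁻ z∈
... | inj₁ refl = x∈S
... | inj₂ refl = y∈S

infix 4 _∖_
_∖_ : Subset n → Fin n → Fin n → Set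
(S ∖ v) z = z ∈ S × z ≢ v

consecutive : Fin n → Fin n → Bool
consecutive zero    zero    = false
consecutive zero    (suc j) = toℕ j ≡ᵇ 0
consecutive (suc i) zero    = toℕ i ≡ᵇ 0
consecutive (suc i) (suc j) = consecutive i j

consecutive-sym : (i j : Fin n) → consecutive i j ≡ consecutive j i
consecutive-sym zero    zero    = refl
consecutive-sym zero    (suc j) = refl
consecutive-sym (suc i) zero    = refl
consecutive-sym (suc i) (suc j) = consecutive-sym i j

consecutive-irrefl : (i : Fin n) → consecutive i i ≡ false
consecutive-irrefl zero    = refl
consecutive-irrefl (suc i) = consecutive-irrefl i

consecutive⇒ : (i j : Fin n) → consecutive i j ≡ true → toℕ j ≡ suc (toℕ i) ⊎ toℕ i ≡ suc (toℕ j)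
consecutive⇒ zero          (suc zero) _ = inj₁ refl
consecutive⇒ (suc zero)    zero       _ = inj₂ refl
consecutive⇒ (suc i)       (suc j)    e = Sum.map (cong suc) (cong suc) (consecutive⇒ i j e)

consecutive⇐ : (i j : Fin n) → toℕ j ≡ suc (toℕ i) → consecutive i j ≡ true
consecutive⇐ zero    (suc zero) _ = refl
consecutive⇐ (suc i) (suc j)    e = consecutive⇐ i j (suc-injective e)

pathGraph : (n : ℕ) → Graph n
pathGraph n = record { adj = consecutive ; sym = consecutive-sym ; irrefl = consecutive-irrefl }

module Walks {n : ℕ} (G : Graph n) where

  private
    variable
      P Q : Fin n → Set
      u v w : Fin n

  Adj : Fin n → Fin n → Set
  Adj u v = adj G u v ≡ true

  Adj-sym : Adj u v → Adj v u
  Adj-sym {u} {v} a = trans (Graph.sym G v u) a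

  Adj⇒≢ : Adj u v → u ≢ v
  Adj⇒≢ {u} a refl with trans (sym a) (irrefl G u)
  ... | ()

  walk-start : Walk G P u w → P u
  walk-start (here p)     = p
  walk-start (step p _ _) = p

  walk-end : Walk G P u w → P w
  walk-end (here p)     = p
  walk-end (step _ _ r) = walk-end r

  mapWalk : (∀ {z} → P z → Q z) → Walk G P u w → Walk G Q u w
  mapWalk f (here p)     = here (f p)
  mapWalk f (step p a r) = step (f p) a (mapWalk f r)

  infixr 5 _++ʷ_
  _++ʷ_ : Walk G P u v → Walk G P v w → Walk G P u w
  here _     ++ʷ r = r
  step p a q ++ʷ r = step p a (q ++ʷ r)

  reverseWalk : Walk G P u w → Walk G P w u
  reverseWalk (here p)     = here p
  reverseWalk (step p a r) = reverseWalk r ++ʷ step (walk-start r) (Adj-sym a) (here p)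

  first-step : Walk G P u w → u ≢ w → ∃[ v ] Adj u v × P v
  first-step (here _)     u≢w = ⊥-elim (u≢w refl)
  first-step (step _ a r) _   = _ , a , walk-start r

  tailVertices : Walk G P u w → List (Fin n)
  vertices     : Walk G P u w → List (Fin n)

  tailVertices (here _)     = []
  tailVertices (step _ _ r) = vertices r

  vertices {u = u} r = u ∷ tailVertices r

  walk-All : (r : Walk G P u w) → All P (vertices r)
  walk-All (here p)     = p ∷ []
  walk-All (step p _ r) = p ∷ walk-All r

  visits-or-avoids : (v : Fin n) (r : Walk G P u w) →
                     v ∈ₗ vertices r ⊎ Walk G (λ z → P z × z ≢ v) u w
  visits-or-avoids v (here {u} p) with v Fin.≟ u
  ... | yes v≡u = inj₁ (here v≡u)
  ... | no  v≢u = inj₂ (here (p , v≢u ∘ sym))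
  visits-or-avoids v (step {u} p a r) with v Fin.≟ u | visits-or-avoids v r
  ... | yes v≡u | _        = inj₁ (here v≡u)
  ... | no  _   | inj₁ v∈r = inj₁ (there v∈r)
  ... | no  v≢u | inj₂ r′  = inj₂ (step (p , v≢u ∘ sym) a r′)

  along-to-start : (r : Walk G P u w) → z ∈ₗ vertices r → Walk G (_∈ₗ vertices r) z u
  along-to-start r            (here refl)  = here (here refl)
  along-to-start (step _ a r) (there z∈r) =
    mapWalk there (along-to-start r z∈r) ++ʷ step (there (here refl)) (Adj-sym a) (here (here refl))

  along-to-end : (r : Walk G P u w) → z ∈ₗ vertices r → Walk G (_∈ₗ vertices r) z w
  along-to-end (here _)     (here refl) = here (here refl)
  along-to-end (step _ a r) (here refl) = step (here refl) a (mapWalk there (along-to-end r (here refl)))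
  along-to-end (step _ _ r) (there z∈r) = mapWalk there (along-to-end r z∈r)

  Induced : Walk G P u w → Set
  Induced (here _)         = Unit
  Induced (step {u} _ _ r) = All (λ z → z ≢ u × adj G u z ≡ false) (tailVertices r) × Induced r

  suffix-from-last : {D : Fin n → Set} → Decidable D → (r : Walk G P u w) → Induced r →
                     Any D (vertices r) →
                     ∃[ v ] D v × Σ (Walk G P v w) λ s → Induced s × All (¬_ ∘ D) (tailVertices s)
  suffix-from-last D? (here p)     _       (here d) = _ , d , here p , tt , []
  suffix-from-last D? (step p a r) induced d∈r with Any.any? D? (vertices r)
  ... | yes d∈tail = suffix-from-last D? r (proj₂ induced) d∈tail
  ... | no  d∉tail with d∈r
  ...   | here d       = _ , d , step p a r , induced , ¬Any⇒All¬ (vertices r) d∉tail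
  ...   | there d∈tail = ⊥-elim (d∉tail d∈tail)

  ClosedNeighbour : Fin n → Fin n → Set
  ClosedNeighbour u z = z ≡ u ⊎ Adj u z

  closedNeighbour? : ∀ u → Decidable (ClosedNeighbour u)
  closedNeighbour? u z = (z Fin.≟ u) ⊎-dec (adj G u z Bool.≟ true)

  -- Past the last vertex of the shortened tail that is u or a neighbour of u, no vertex is
  -- either, so u can be attached there.
  shortcut : Walk G P u w → Σ (Walk G P u w) Induced
  shortcut (here p) = here p , tt
  shortcut (step {u} p a r) with shortcut r
  ... | q , q-induced with suffix-from-last (closedNeighbour? u) q q-induced (here (inj₂ a))
  ... | _ , inj₁ refl , s , s-induced , _   = s , s-induced
  ... | _ , inj₂ a′   , s , s-induced , far = step p a′ s , All.map outside far , s-induced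
    where
      outside : ¬ ClosedNeighbour u z → z ≢ u × adj G u z ≡ false
      outside z∉N[u] = z∉N[u] ∘ inj₁ , ¬-not (z∉N[u] ∘ inj₂)

  -- v occurs at most once on r, so one of the two ends is reachable along r without it.
  along-avoiding : (r : Walk G P u w) → Induced r → z ∈ₗ vertices r → z ≢ v →
                   Walk G (λ y → y ∈ₗ vertices r × y ≢ v) z u ⊎ Walk G (λ y → y ∈ₗ vertices r × y ≢ v) z w
  along-avoiding r _ (here refl) z≢v = inj₁ (here (here refl , z≢v))
  along-avoiding {v = v} (step {u} _ a r) (far , r-induced) (there z∈r) z≢v
    with along-avoiding r r-induced z∈r z≢v | u Fin.≟ v
  ... | inj₂ to-end   | _       = inj₂ (mapWalk (map₁ there) to-end)
  ... | inj₁ to-start | no  u≢v =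
    inj₁ (mapWalk (map₁ there) to-start ++ʷ
          step (there (here refl) , proj₂ (walk-end to-start)) (Adj-sym a) (here (here refl , u≢v)))
  ... | inj₁ _        | yes refl = inj₂ (mapWalk (λ y∈r → there y∈r , avoids y∈r) (along-to-end r z∈r))
    where
      avoids : y ∈ₗ vertices r → y ≢ u
      avoids (here refl) = Adj⇒≢ a ∘ sym
      avoids (there y∈r) = proj₁ (All.lookup far y∈r)

  induced⇒pathGraph-embedding : (r : Walk G P u w) → Induced r →
                                InducedSubgraph (pathGraph (length (vertices r))) G
  induced⇒pathGraph-embedding r r-induced =
    lookup (vertices r) , lookup-injective r r-induced , adjacency r r-induced
    where
      All-at : ∀ {xs} {R : Fin n → Set} → All R xs → ∀ i → R (lookup xs i)
      All-at rs i = All.lookup rs (∈-lookup i)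

      lookup-injective : ∀ {u w} (r : Walk G P u w) → Induced r → ∀ i j →
                  lookup (vertices r) i ≡ lookup (vertices r) j → i ≡ j
      lookup-injective r _ zero zero _ = refl
      lookup-injective (step _ a _) _ zero (suc zero) e = ⊥-elim (Adj⇒≢ a e)
      lookup-injective (step _ a _) (far , _) zero (suc (suc j)) e = ⊥-elim (proj₁ (All-at far j) (sym e))
      lookup-injective (step _ a _) _ (suc zero) zero e = ⊥-elim (Adj⇒≢ a (sym e))
      lookup-injective (step _ a _) (far , _) (suc (suc i)) zero e = ⊥-elim (proj₁ (All-at far i) e)
      lookup-injective (step _ _ r) (_ , induced) (suc i) (suc j) e =
        cong suc (lookup-injective r induced i j e)

      adjacency : ∀ {u w} (r : Walk G P u w) → Induced r → ∀ i j →
                  consecutive i j ≡ adj G (lookup (vertices r) i) (lookup (vertices r) j)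
      adjacency r _ zero zero = sym (irrefl G _)
      adjacency (step _ a _) _ zero (suc zero) = sym a
      adjacency (step _ _ _) (far , _) zero (suc (suc j)) = sym (proj₂ (All-at far j))
      adjacency (step _ a _) _ (suc zero) zero = sym (Adj-sym a)
      adjacency (step {u} _ _ _) (far , _) (suc (suc i)) zero =
        sym (trans (Graph.sym G _ u) (proj₂ (All-at far i)))
      adjacency (step _ _ r) (_ , induced) (suc i) (suc j) = adjacency r induced i j

module Blocks {n : ℕ} (G : Graph n) where

  open Walks G

  private
    variable
      u v w : Fin n
      S B B′ : Subset n

  walk-avoiding : Connected G S → NoCutvertex G S → u ∈ S → w ∈ S → u ≢ v → w ≢ v →
                  ¬ ¬ Walk G (S ∖ v) u w
  walk-avoiding {S} {u} {w} {v} (_ , connect) no-cut u∈S w∈S u≢v w≢v ¬walk with v ∈? S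
  ... | yes v∈S = no-cut v (v∈S , u , w , u∈S , w∈S , u≢v , w≢v , connect u w u∈S w∈S , ¬walk)
  ... | no  v∉S = ¬walk (mapWalk (λ z∈S → z∈S , λ z≡v → v∉S (subst (_∈ S) z≡v z∈S)) (connect u w u∈S w∈S))

  connected-via : x ∈ S → (∀ {z} → z ∈ S → Walk G (_∈ S) z x) → Connected G S
  connected-via x∈S to-x = (_ , x∈S) , λ u w u∈S w∈S → to-x u∈S ++ʷ reverseWalk (to-x w∈S)

  noCutvertex-via : (∀ {v} → v ∈ S → ∃[ h ] ∀ {z} → z ∈ S → z ≢ v → ¬ ¬ Walk G (S ∖ v) z h) →
                    NoCutvertex G S
  noCutvertex-via hub v (v∈S , u , w , u∈S , w∈S , u≢v , w≢v , _ , ¬walk) with hub v∈S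
  ... | h , to-h = to-h u∈S u≢v λ u→h → to-h w∈S w≢v λ w→h → ¬walk (u→h ++ʷ reverseWalk w→h)

  pair-connected : Adj x y → Connected G (⁅ x ⁆ ∪ ⁅ y ⁆)
  pair-connected {x} {y} a = connected-via x∈pair to-x
    where
      to-x : z ∈ ⁅ x ⁆ ∪ ⁅ y ⁆ → Walk G (_∈ ⁅ x ⁆ ∪ ⁅ y ⁆) z x
      to-x z∈ with ∈pair⁻ z∈
      ... | inj₁ refl = here z∈
      ... | inj₂ refl = step z∈ (Adj-sym a) (here x∈pair)

  pair-noCutvertex : NoCutvertex G (⁅ x ⁆ ∪ ⁅ y ⁆)
  pair-noCutvertex {x} {y} = noCutvertex-via λ v∈ → other v∈ , at-other v∈
    where
      other : v ∈ ⁅ x ⁆ ∪ ⁅ y ⁆ → Fin n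
      other v∈ = [ (λ _ → y) , (λ _ → x) ]′ (∈pair⁻ v∈)
      at-other : (v∈ : v ∈ ⁅ x ⁆ ∪ ⁅ y ⁆) → z ∈ ⁅ x ⁆ ∪ ⁅ y ⁆ → z ≢ v →
                 ¬ ¬ Walk G ((⁅ x ⁆ ∪ ⁅ y ⁆) ∖ v) z (other v∈)
      at-other v∈ z∈ z≢v ¬walk with ∈pair⁻ v∈ | ∈pair⁻ z∈
      ... | inj₁ refl | inj₁ refl = z≢v refl
      ... | inj₁ refl | inj₂ refl = ¬walk (here (z∈ , z≢v))
      ... | inj₂ refl | inj₁ refl = ¬walk (here (z∈ , z≢v))
      ... | inj₂ refl | inj₂ refl = z≢v refl

  block-neighbour : IsBlock G B → x ∈ B → Adj x y → ∃[ y′ ] y′ ∈ B × Adj x y′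
  block-neighbour {B} {x} {y} ((_ , connect) , _ , maximal) x∈B a
    with Fin.any? (λ y′ → (y′ ∈? B) ×-dec (adj G x y′ Bool.≟ true))
  ... | yes found = found
  ... | no  none  = ⊥-elim (none (y , subst (y ∈_) pair≡B y∈pair , a))
    where
      B⊆pair : B ⊆ ⁅ x ⁆ ∪ ⁅ y ⁆
      B⊆pair {z} z∈B with z Fin.≟ x
      ... | yes refl = x∈pair
      ... | no  z≢x with first-step (connect x z x∈B z∈B) (z≢x ∘ sym)
      ...   | y′ , a′ , y′∈B = ⊥-elim (none (y′ , y′∈B , a′))
      pair≡B : ⁅ x ⁆ ∪ ⁅ y ⁆ ≡ B
      pair≡B = maximal _ B⊆pair (pair-connected a) pair-noCutvertex

  module Bridge {B B′ : Subset n} {c x y : Fin n} (B-block : IsBlock G B) (B′-block : IsBlock G B′)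
                (c∈B : c ∈ B) (c∈B′ : c ∈ B′) (x∈B : x ∈ B) (y∈B′ : y ∈ B′)
                (q : Walk G (_≢ c) x y) (q-induced : Induced q) where

    U : Subset n
    U = B ∪ (B′ ∪ fromList (vertices q))

    B⊆U : B ⊆ U
    B⊆U z∈B = x∈p∪q⁺ (inj₁ z∈B)

    B′⊆U : B′ ⊆ U
    B′⊆U z∈B′ = x∈p∪q⁺ (inj₂ (x∈p∪q⁺ (inj₁ z∈B′)))

    q⊆U : z ∈ₗ vertices q → z ∈ U
    q⊆U z∈q = x∈p∪q⁺ (inj₂ (x∈p∪q⁺ (inj₂ (∈-fromList⁺ z∈q))))

    U-cases : z ∈ U → z ∈ B ⊎ z ∈ B′ ⊎ z ∈ₗ vertices q
    U-cases z∈U = Sum.map₂ (Sum.map₂ (∈-fromList⁻ _) ∘ x∈p∪q⁻ B′ _) (x∈p∪q⁻ B _ z∈U)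

    inside : {X : Fin n → Set} → (∀ {z} → X z → z ∈ U) → Walk G (λ z → X z × z ≢ v) u w → Walk G (U ∖ v) u w
    inside X⊆U = mapWalk (map₁ X⊆U)

    avoid : ∀ {X} → IsBlock G X → u ∈ X → w ∈ X → u ≢ v → w ≢ v → ¬ ¬ Walk G (X ∖ v) u w
    avoid (X-connected , X-noCutvertex , _) = walk-avoiding X-connected X-noCutvertex

    x≢c : x ≢ c
    x≢c = walk-start q

    y≢c : y ≢ c
    y≢c = walk-end q

    on-q : z ∈ₗ vertices q → (U ∖ c) z
    on-q z∈q = q⊆U z∈q , All.lookup (walk-All q) z∈q

    U-connected : Connected G U
    U-connected = connected-via (B⊆U c∈B) to-c
      where
        to-c : z ∈ U → Walk G (_∈ U) z c
        to-c {z} z∈U with U-cases z∈U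
        ... | inj₁ z∈B         = mapWalk B⊆U (proj₂ (proj₁ B-block) z c z∈B c∈B)
        ... | inj₂ (inj₁ z∈B′) = mapWalk B′⊆U (proj₂ (proj₁ B′-block) z c z∈B′ c∈B′)
        ... | inj₂ (inj₂ z∈q)  = mapWalk q⊆U (along-to-start q z∈q) ++ʷ
                                 mapWalk B⊆U (proj₂ (proj₁ B-block) x c x∈B c∈B)

    around-c : z ∈ U → z ≢ c → ¬ ¬ Walk G (U ∖ c) z x
    around-c z∈U z≢c with U-cases z∈U
    ... | inj₁ z∈B         = ¬¬-map (inside B⊆U) (avoid B-block z∈B x∈B z≢c x≢c)
    ... | inj₂ (inj₁ z∈B′) = ¬¬-map (λ z→y → inside B′⊆U z→y ++ʷ y→x) (avoid B′-block z∈B′ y∈B′ z≢c y≢c)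
      where
        y→x = mapWalk on-q (reverseWalk (along-to-end q (here refl)))
    ... | inj₂ (inj₂ z∈q)  = λ ¬walk → ¬walk (mapWalk on-q (along-to-start q z∈q))

    through-c : v ≢ c → z ∈ U → z ≢ v → ¬ ¬ Walk G (U ∖ v) z c
    through-c v≢c z∈U z≢v with U-cases z∈U
    ... | inj₁ z∈B         = ¬¬-map (inside B⊆U) (avoid B-block z∈B c∈B z≢v (v≢c ∘ sym))
    ... | inj₂ (inj₁ z∈B′) = ¬¬-map (inside B′⊆U) (avoid B′-block z∈B′ c∈B′ z≢v (v≢c ∘ sym))
    ... | inj₂ (inj₂ z∈q) with along-avoiding q q-induced z∈q z≢v
    ...   | inj₁ z→x = ¬¬-map (λ x→c → inside q⊆U z→x ++ʷ inside B⊆U x→c)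
                              (avoid B-block x∈B c∈B (proj₂ (walk-end z→x)) (v≢c ∘ sym))
    ...   | inj₂ z→y = ¬¬-map (λ y→c → inside q⊆U z→y ++ʷ inside B′⊆U y→c)
                              (avoid B′-block y∈B′ c∈B′ (proj₂ (walk-end z→y)) (v≢c ∘ sym))

    -- Without c every vertex still reaches x, those of B′ through q; without any other v
    -- every vertex reaches c, those of q through whichever end of q they reach avoiding v.
    U-noCutvertex : NoCutvertex G U
    U-noCutvertex = noCutvertex-via hub
      where
        hub : v ∈ U → ∃[ h ] ∀ {z} → z ∈ U → z ≢ v → ¬ ¬ Walk G (U ∖ v) z h
        hub {v} _ with v Fin.≟ c
        ... | yes refl = x , around-c
        ... | no  v≢c  = c , through-c v≢c

  shared-vertex-separates-blocks : IsBlock G B → IsBlock G B′ → B ≢ B′ → ∀ {c} → c ∈ B → c ∈ B′ →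
                                   x ∈ B → y ∈ B′ → ¬ Walk G (_≢ c) x y
  shared-vertex-separates-blocks {B} {B′} B-block B′-block B≢B′ c∈B c∈B′ x∈B y∈B′ r with shortcut r
  ... | q , q-induced = B≢B′ (B′-maximal B B′⊆B B-connected B-noCutvertex)
    where
      open Bridge B-block B′-block c∈B c∈B′ x∈B y∈B′ q q-induced
      B-connected   = proj₁ B-block
      B-noCutvertex = proj₁ (proj₂ B-block)
      B-maximal     = proj₂ (proj₂ B-block)
      B′-maximal    = proj₂ (proj₂ B′-block)
      U≡B : U ≡ B
      U≡B = B-maximal U B⊆U U-connected U-noCutvertex
      B′⊆B : B′ ⊆ B
      B′⊆B z∈B′ = subst (_ ∈_) U≡B (B′⊆U z∈B′)

record BlockSequence {n : ℕ} (G : Graph n) (t : ℕ) : Set where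
  field
    cut            : ℕ → Fin n
    block          : ℕ → Subset n
    block-isBlock  : ∀ {j} → j < t → IsBlock G (block j)
    cut∈block      : ∀ {j} → j < t → cut j ∈ block j
    next-cut∈block : ∀ {j} → j < t → cut (suc j) ∈ block j
    block≢next     : ∀ {j} → suc j < t → block j ≢ block (suc j)
    cut-injective  : ∀ {i j} → i ≤ t → j ≤ t → cut i ≡ cut j → i ≡ j

module _ {n t : ℕ} {G : Graph n} (S : BlockSequence G t) where

  open BlockSequence S
  open Walks G
  open Blocks G

  walk-along : ∀ {j} → j ≤ t → Walk G (λ _ → Unit) (cut 0) (cut j)
  walk-along {zero}  _   = here tt
  walk-along {suc j} j<t =
    walk-along (<⇒≤ j<t) ++ʷ mapWalk (λ _ → tt) (connect (cut∈block j<t) (next-cut∈block j<t))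
    where
      connect = proj₂ (proj₁ (block-isBlock j<t)) _ _

  walk-along-avoiding : ∀ {a j v} → a ≤ j → j ≤ t → (∀ {k} → a ≤ k → k ≤ j → cut k ≢ v) →
                        ¬ ¬ Walk G (_≢ v) (cut a) (cut j)
  walk-along-avoiding a≤j j≤t avoids with m≤n⇒m<n∨m≡n a≤j
  ... | inj₂ refl = λ ¬walk → ¬walk (here (avoids ≤-refl ≤-refl))
  walk-along-avoiding {j = suc j} _ j<t avoids | inj₁ (s≤s a≤j) = λ ¬walk →
    walk-along-avoiding a≤j (<⇒≤ j<t) (λ a≤k k≤j → avoids a≤k (≤-trans k≤j (n≤1+n j))) λ a→j →
    walk-avoiding (proj₁ j-block) (proj₁ (proj₂ j-block)) (cut∈block j<t) (next-cut∈block j<t)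
      (avoids a≤j (n≤1+n j)) (avoids (≤-trans a≤j (n≤1+n j)) ≤-refl) λ j→j+1 →
    ¬walk (a→j ++ʷ mapWalk proj₂ j→j+1)
    where
      j-block = block-isBlock j<t

  cut-separates : ∀ {i} → i ≤ t → ¬ Walk G (_≢ cut i) (cut 0) (cut t)
  cut-separates {zero}  _ r = walk-start r refl
  cut-separates {suc i} i+1≤t r with m≤n⇒m<n∨m≡n i+1≤t
  ... | inj₂ i+1≡t = walk-end r (cong cut (sym i+1≡t))
  ... | inj₁ i+1<t =
    walk-along-avoiding z≤n i≤t (λ _ k≤i → cut≢ (≤-trans k≤i i≤t) λ { refl → 1+n≰n k≤i }) λ r₁ →
    walk-along-avoiding i+1<t ≤-refl (λ i+2≤k k≤t → cut≢ k≤t λ { refl → 1+n≰n i+2≤k }) λ r₂ →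
    shared-vertex-separates-blocks (block-isBlock i<t) (block-isBlock i+1<t) (block≢next i+1<t)
      (next-cut∈block i<t) (cut∈block i+1<t) (cut∈block i<t) (next-cut∈block i+1<t)
      (reverseWalk r₁ ++ʷ r ++ʷ reverseWalk r₂)
    where
      i<t = <⇒≤ i+1<t
      i≤t = <⇒≤ i<t
      cut≢ : ∀ {k} → k ≤ t → k ≢ suc i → cut k ≢ cut (suc i)
      cut≢ k≤t k≢i+1 = k≢i+1 ∘ cut-injective k≤t i+1≤t

  cut∈walk : ∀ {i} {P : Fin n → Set} → i ≤ t → (r : Walk G P (cut 0) (cut t)) → cut i ∈ₗ vertices r
  cut∈walk {i} i≤t r with visits-or-avoids (cut i) r
  ... | inj₁ on       = on
  ... | inj₂ avoiding = ⊥-elim (cut-separates i≤t (mapWalk proj₂ avoiding))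

  long-induced-path : Σ (Walk G (λ _ → Unit) (cut 0) (cut t)) λ q → Induced q × t ≤ length (tailVertices q)
  long-induced-path with shortcut (walk-along ≤-refl)
  ... | q , q-induced = q , q-induced , ≤-pred (injective-into-list (cut ∘ toℕ) cuts-injective cuts∈q)
    where
      cuts-injective : ∀ {i j : Fin (suc t)} → cut (toℕ i) ≡ cut (toℕ j) → i ≡ j
      cuts-injective {i} {j} = Fin.toℕ-injective ∘ cut-injective (Fin.toℕ≤pred[n] i) (Fin.toℕ≤pred[n] j)
      cuts∈q : (i : Fin (suc t)) → cut (toℕ i) ∈ₗ vertices q
      cuts∈q i = cut∈walk (Fin.toℕ≤pred[n] i) q

module _ {n : ℕ} {G : Graph n} where

  dropFirst : BCPath G (suc k) → BCPath G k
  dropFirst P = record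
    { node     = node P ∘ suc
    ; valid    = valid P ∘ suc
    ; distinct = λ i j → Fin.suc-injective ∘ distinct P (suc i) (suc j)
    ; consec   = λ i j → consec P (suc i) (suc j) ∘ cong suc
    }

  dropLast : BCPath G (suc k) → BCPath G k
  dropLast P = record
    { node     = node P ∘ inject₁
    ; valid    = valid P ∘ inject₁
    ; distinct = λ i j → Fin.inject₁-injective ∘ distinct P (inject₁ i) (inject₁ j)
    ; consec   = λ i j j≡1+i → consec P (inject₁ i) (inject₁ j)
                   (trans (Fin.toℕ-inject₁ j) (trans j≡1+i (cong suc (sym (Fin.toℕ-inject₁ i)))))
    }

  cut-follows-block : {B : Subset n} {y : BCNode n} → BCAdj (inj₂ B) y → ∃[ v ] y ≡ inj₁ v
  cut-follows-block {y = inj₁ v} _ = v , refl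

  block-follows-cut : {v : Fin n} {y : BCNode n} → BCAdj (inj₁ v) y → ∃[ B ] y ≡ inj₂ B
  block-follows-cut {y = inj₂ B} _ = B , refl

  BCAdj-substˡ : {x y z : BCNode n} → x ≡ y → BCAdj x z → BCAdj y z
  BCAdj-substˡ refl a = a

  countBlocks-cut : {v : Fin n} (f : Fin (suc k) → BCNode n) → f zero ≡ inj₁ v →
                    countBlocks f ≡ countBlocks (f ∘ suc)
  countBlocks-cut f f₀ rewrite f₀ = refl

  countBlocks-block : {B : Subset n} (f : Fin (suc k) → BCNode n) → f zero ≡ inj₂ B →
                      countBlocks f ≡ suc (countBlocks (f ∘ suc))
  countBlocks-block f f₀ rewrite f₀ = refl

  countBlocks-alternating : (P : BCPath G (suc (double m))) → {B : Subset n} → node P zero ≡ inj₂ B →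
                            countBlocks (node P) ≡ suc m
  countBlocks-alternating {zero}  P first = countBlocks-block (node P) first
  countBlocks-alternating {suc m} P first =
    trans (countBlocks-block (node P) first)
          (cong suc (trans (countBlocks-cut (node P ∘ suc) second)
                           (countBlocks-alternating (dropFirst (dropFirst P)) third)))
    where
      second = proj₂ (cut-follows-block (BCAdj-substˡ first (consec P zero (suc zero) refl)))
      third  = proj₂ (block-follows-cut (BCAdj-substˡ second (consec P (suc zero) (suc (suc zero)) refl)))

  startAtCutvertex : BCPath G (suc (suc k)) → Σ (BCPath G (suc k)) λ P → ∃[ c ] node P zero ≡ inj₁ c
  startAtCutvertex P with node P zero in node₀ | consec P zero (suc zero) refl
  ... | inj₁ c | _   = dropLast P , c , node₀
  ... | inj₂ B | adj = dropFirst P , cut-follows-block adj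

  module FromBCPath {t : ℕ} (P : BCPath G (suc (double t))) {c₀ : Fin n}
                    (starts : node P zero ≡ inj₁ c₀) where

    at : ℕ → BCNode n
    at i = node P (clamp i)

    at-adj : suc i ≤ double t → BCAdj (at i) (at (suc i))
    at-adj {i} i<2t = consec P (clamp i) (clamp (suc i))
                        (trans (toℕ-clamp i<2t) (cong suc (sym (toℕ-clamp (<⇒≤ i<2t)))))

    at-injective : i ≤ double t → j ≤ double t → at i ≡ at j → i ≡ j
    at-injective i≤2t j≤2t e = clamp-injective i≤2t j≤2t (distinct P _ _ e)

    -- c₀ and ⊤ are junk values, never taken in range (cut-node, block-node).
    cutOf : BCNode n → Fin n
    cutOf (inj₁ v) = v
    cutOf (inj₂ _) = c₀

    blockOf : BCNode n → Subset n
    blockOf (inj₁ _) = ⊤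
    blockOf (inj₂ B) = B

    cut : ℕ → Fin n
    cut j = cutOf (at (double j))

    block : ℕ → Subset n
    block j = blockOf (at (suc (double j)))

    as-cut : ∀ {x v} → x ≡ inj₁ v → x ≡ inj₁ (cutOf x)
    as-cut refl = refl

    as-block : ∀ {x B} → x ≡ inj₂ B → x ≡ inj₂ (blockOf x)
    as-block refl = refl

    block-index< : j < t → suc (double j) < double t
    block-index< j<t = double-mono-≤ j<t

    cut-node   : j ≤ t → at (double j) ≡ inj₁ (cut j)
    block-node : j < t → at (suc (double j)) ≡ inj₂ (block j)

    cut-node {zero}  _   = as-cut starts
    cut-node {suc j} j<t =
      as-cut (proj₂ (cut-follows-block (BCAdj-substˡ (block-node j<t) (at-adj (block-index< j<t)))))

    block-node j<t =
      as-block (proj₂ (block-follows-cut (BCAdj-substˡ (cut-node (<⇒≤ j<t)) (at-adj (<⇒≤ (block-index< j<t))))))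

    blockSequence : BlockSequence G t
    blockSequence = record
      { cut            = cut
      ; block          = block
      ; block-isBlock  = λ j<t → subst (ValidNode G) (block-node j<t) (valid P _)
      ; cut∈block      = λ j<t → subst₂ BCAdj (cut-node (<⇒≤ j<t)) (block-node j<t)
                                    (at-adj (<⇒≤ (block-index< j<t)))
      ; next-cut∈block = λ j<t → subst₂ BCAdj (block-node j<t) (cut-node j<t) (at-adj (block-index< j<t))
      ; block≢next     = λ j+1<t e → <⇒≢ (m<n⇒m<1+n (n<1+n _))
                           (at-injective (<⇒≤ (block-index< (<⇒≤ j+1<t))) (<⇒≤ (block-index< j+1<t))
                             (trans (block-node (<⇒≤ j+1<t)) (trans (cong inj₂ e) (sym (block-node j+1<t)))))
      ; cut-injective  = λ i≤t j≤t e → double-injective (at-injective (double-mono-≤ i≤t) (double-mono-≤ j≤t)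
                           (trans (cut-node i≤t) (trans (cong inj₁ e) (sym (cut-node j≤t)))))
      }

  bcPath⇒blockSequence : ∀ {t} → BCPath G (suc (suc (double t))) → BlockSequence G t
  bcPath⇒blockSequence P with startAtCutvertex P
  ... | P′ , _ , starts = FromBCPath.blockSequence P′ starts

module PathGraph (m : ℕ) where

  L : ℕ
  L = suc m

  H : Graph (suc L)
  H = pathGraph (suc L)

  open Walks H
  open Blocks H

  private
    variable
      P : Fin (suc L) → Set
      u v w : Fin (suc L)
      S B : Subset (suc L)

  stays-below : Walk H P u w → (∀ {z} → P z → toℕ z ≢ k) → toℕ u < k → toℕ w < k
  stays-below (here _)     _      u<k = u<k
  stays-below {u = u} (step {v = v} _ a r) avoids u<k with consecutive⇒ u v a
  ... | inj₁ v≡1+u = stays-below r avoids (≤∧≢⇒< (subst (_≤ _) (sym v≡1+u) u<k) (avoids (walk-start r)))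
  ... | inj₂ u≡1+v = stays-below r avoids (<-trans (≤-reflexive (sym u≡1+v)) u<k)

  no-crossing : Walk H P u w → (∀ {z} → P z → z ≢ clamp k) → toℕ u < k → k < toℕ w → ⊥
  no-crossing r avoids u<k k<w = <-asym (stays-below r (λ p → avoids p ∘ toℕ≡⇒≡clamp) u<k) k<w

  clamp-suc : j < L → toℕ (clamp {L} (suc j)) ≡ suc (toℕ (clamp {L} j))
  clamp-suc j<L = trans (toℕ-clamp j<L) (cong suc (sym (toℕ-clamp (<⇒≤ j<L))))

  clamp-between : k ≤ L → i ≤ k → k ≤ j → i ≤ toℕ (clamp {L} k) × toℕ (clamp {L} k) ≤ j
  clamp-between k≤L i≤k k≤j rewrite toℕ-clamp k≤L = i≤k , k≤j

  ascending : i ≤ j → j ≤ L → Walk H (λ z → i ≤ toℕ z × toℕ z ≤ j) (clamp i) (clamp j)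
  ascending i≤j j≤L with m≤n⇒m<n∨m≡n i≤j
  ... | inj₂ refl = here (clamp-between j≤L ≤-refl ≤-refl)
  ascending {i} {suc j} _ j<L | inj₁ (s≤s i≤j) =
    mapWalk (map₂ (λ z≤j → ≤-trans z≤j (n≤1+n j))) (ascending i≤j (<⇒≤ j<L)) ++ʷ
    step (clamp-between (<⇒≤ j<L) i≤j (n≤1+n j)) (consecutive⇐ _ _ (clamp-suc j<L))
         (here (clamp-between j<L (≤-trans i≤j (n≤1+n j)) ≤-refl))

  no-gap : Connected H S → NoCutvertex H S → u ∈ S → w ∈ S → suc (suc (toℕ u)) ≤ toℕ w → ⊥
  no-gap {S} {u} {w} (_ , connect) no-cut u∈S w∈S u+2≤w = separated (mid ∈? S)
    where
      mid = clamp (suc (toℕ u))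
      mid≡ : toℕ mid ≡ suc (toℕ u)
      mid≡ = toℕ-clamp (≤-trans (n≤1+n _) (≤-trans u+2≤w (Fin.toℕ≤pred[n] w)))
      u≢mid : u ≢ mid
      u≢mid e = <⇒≢ (n<1+n _) (trans (cong toℕ e) mid≡)
      w≢mid : w ≢ mid
      w≢mid e = 1+n≰n (subst (suc (suc (toℕ u)) ≤_) (trans (cong toℕ e) mid≡) u+2≤w)
      separated : Dec (mid ∈ S) → ⊥
      separated (yes mid∈S) = no-cut mid (mid∈S , u , w , u∈S , w∈S , u≢mid , w≢mid , connect u w u∈S w∈S ,
                                          λ r → no-crossing r proj₂ (n<1+n _) u+2≤w)
      separated (no  mid∉S) = no-crossing (connect u w u∈S w∈S)
                                          (λ z∈S z≡mid → mid∉S (subst (_∈ S) z≡mid z∈S)) (n<1+n _) u+2≤w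

  ⊆pair : Connected H S → NoCutvertex H S → x ∈ S → y ∈ S → toℕ y ≡ suc (toℕ x) → S ⊆ ⁅ x ⁆ ∪ ⁅ y ⁆
  ⊆pair {x = x} {y = y} conn no-cut x∈S y∈S y≡1+x {z} z∈S with <-cmp (toℕ z) (toℕ x)
  ... | tri< z<x _ _ =
    ⊥-elim (no-gap conn no-cut z∈S y∈S (subst (suc (suc (toℕ z)) ≤_) (sym y≡1+x) (s≤s z<x)))
  ... | tri≈ _ z≡x _ = subst (_∈ _) (sym (Fin.toℕ-injective z≡x)) x∈pair
  ... | tri> _ _ x<z with m≤n⇒m<n∨m≡n x<z
  ...   | inj₂ 1+x≡z = subst (_∈ _) (Fin.toℕ-injective (trans y≡1+x 1+x≡z)) y∈pair
  ...   | inj₁ 1+x<z = ⊥-elim (no-gap conn no-cut x∈S z∈S 1+x<z)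

  pair-isBlock : toℕ y ≡ suc (toℕ x) → IsBlock H (⁅ x ⁆ ∪ ⁅ y ⁆)
  pair-isBlock {y} {x} y≡1+x = pair-connected (consecutive⇐ x y y≡1+x) , pair-noCutvertex , maximal
    where
      maximal : ∀ S → ⁅ x ⁆ ∪ ⁅ y ⁆ ⊆ S → Connected H S → NoCutvertex H S → S ≡ ⁅ x ⁆ ∪ ⁅ y ⁆
      maximal S pair⊆S conn no-cut =
        ⊆-antisym (⊆pair conn no-cut (pair⊆S x∈pair) (pair⊆S y∈pair) y≡1+x) pair⊆S

  edge : ℕ → Subset (suc L)
  edge j = ⁅ clamp j ⁆ ∪ ⁅ clamp (suc j) ⁆

  edge-isBlock : j < L → IsBlock H (edge j)
  edge-isBlock j<L = pair-isBlock (clamp-suc j<L)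

  edge-injective : j < L → k < L → edge j ≡ edge k → j ≡ k
  edge-injective {j} {k} j<L k<L e
    with ∈pair⁻ (subst (clamp j ∈_) e (x∈pair {y = clamp (suc j)}))
       | ∈pair⁻ (subst (clamp k ∈_) (sym e) (x∈pair {y = clamp (suc k)}))
  ... | inj₁ j≡k | _        = clamp-injective (<⇒≤ j<L) (<⇒≤ k<L) j≡k
  ... | inj₂ _   | inj₁ k≡j = sym (clamp-injective (<⇒≤ k<L) (<⇒≤ j<L) k≡j)
  ... | inj₂ j≡k+1 | inj₂ k≡j+1 =
    ⊥-elim (<-asym (≤-reflexive (sym (clamp-injective (<⇒≤ j<L) k<L j≡k+1)))
                   (≤-reflexive (sym (clamp-injective (<⇒≤ k<L) j<L k≡j+1))))

  neighbour : (x : Fin (suc L)) → ∃[ y ] Adj x y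
  neighbour zero    = suc zero , refl
  neighbour (suc x) =
    inject₁ x , Adj-sym {inject₁ x} {suc x} (consecutive⇐ (inject₁ x) (suc x) (cong suc (sym (Fin.toℕ-inject₁ x))))

  block-through : IsBlock H B → x ∈ B → y ∈ B → toℕ y ≡ suc (toℕ x) → ∃[ j ] j < L × B ≡ edge j
  block-through {x = x} {y = y} (conn , no-cut , _) x∈B y∈B y≡1+x = toℕ x , x<L , B≡edge
    where
      x<L = subst (_≤ L) y≡1+x (Fin.toℕ≤pred[n] y)
      B≡edge = trans (⊆-antisym (⊆pair conn no-cut x∈B y∈B y≡1+x) (pair⊆ x∈B y∈B))
                     (cong₂ (λ a b → ⁅ a ⁆ ∪ ⁅ b ⁆) (sym (clamp-toℕ x)) (toℕ≡⇒≡clamp y≡1+x))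

  block⇒edge : IsBlock H B → ∃[ j ] j < L × B ≡ edge j
  block⇒edge B-block@(((x , x∈B) , _) , _) with block-neighbour B-block x∈B (proj₂ (neighbour x))
  ... | y , y∈B , a with consecutive⇒ x y a
  ... | inj₁ y≡1+x = block-through B-block x∈B y∈B y≡1+x
  ... | inj₂ x≡1+y = block-through B-block y∈B x∈B x≡1+y

  internal-isCutvertex : suc j < L → IsCutvertex H (clamp (suc j))
  internal-isCutvertex {j} j+1<L =
    ∈⊤ , clamp j , clamp (suc (suc j)) , ∈⊤ , ∈⊤ , below≢ , above≢ ,
    mapWalk (λ _ → ∈⊤) (ascending (≤-trans (n≤1+n j) (n≤1+n _)) j+1<L) ,
    λ r → no-crossing r proj₂ (subst (_< suc j) (sym (toℕ-clamp j≤L)) (n<1+n j))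
                                (subst (suc j <_) (sym (toℕ-clamp j+1<L)) (n<1+n _))
    where
      j≤L = ≤-trans (n≤1+n j) (<⇒≤ j+1<L)
      below≢ : clamp j ≢ clamp (suc j)
      below≢ e = <⇒≢ (n<1+n j) (clamp-injective j≤L (<⇒≤ j+1<L) e)
      above≢ : clamp (suc (suc j)) ≢ clamp (suc j)
      above≢ e = <⇒≢ (n<1+n (suc j)) (sym (clamp-injective j+1<L (<⇒≤ j+1<L) e))

  avoiding-by-index : {Q : Fin (suc L) → Set} → z ≢ v → (∀ {y} → Q y → toℕ y ≡ toℕ v → toℕ z ≡ toℕ v) →
                      Walk H Q z w → Walk H (⊤ ∖ v) z w
  avoiding-by-index z≢v forces =
    mapWalk λ q → ∈⊤ , λ y≡v → z≢v (Fin.toℕ-injective (forces q (cong toℕ y≡v)))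

  from-clamp : {Q : Fin (suc L) → Set} → Walk H Q (clamp (toℕ z)) w → Walk H Q z w
  from-clamp {z = z} = subst (λ a → Walk H _ a _) (clamp-toℕ z)

  cutvertex-internal : IsCutvertex H v → ∃[ j ] suc j < L × v ≡ clamp (suc j)
  cutvertex-internal {v} (_ , u , w , _ , _ , u≢v , w≢v , _ , ¬walk) with toℕ v in v≡
  ... | zero = ⊥-elim (¬walk (to-top u≢v ++ʷ reverseWalk (to-top w≢v)))
    where
      to-top : z ≢ v → Walk H (⊤ ∖ v) z (clamp L)
      to-top {z} z≢v = avoiding-by-index z≢v
        (λ (z≤y , _) y≡v → trans (n≤0⇒n≡0 (subst (toℕ z ≤_) (trans y≡v v≡) z≤y)) (sym v≡))
        (from-clamp (ascending (Fin.toℕ≤pred[n] z) ≤-refl))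
  ... | suc j with suc j <? L
  ...   | yes j+1<L = j , j+1<L , toℕ≡⇒≡clamp v≡
  ...   | no  j+1≮L = ⊥-elim (¬walk (to-bottom u≢v ++ʷ reverseWalk (to-bottom w≢v)))
    where
      v≡L : toℕ v ≡ L
      v≡L = ≤-antisym (Fin.toℕ≤pred[n] v) (subst (L ≤_) (sym v≡) (≮⇒≥ j+1≮L))
      to-bottom : z ≢ v → Walk H (⊤ ∖ v) z (clamp 0)
      to-bottom {z} z≢v = avoiding-by-index z≢v
        (λ (_ , y≤z) y≡v → trans (≤-antisym (Fin.toℕ≤pred[n] z) (subst (_≤ toℕ z) (trans y≡v v≡L) y≤z)) (sym v≡L))
        (from-clamp (reverseWalk (ascending z≤n (Fin.toℕ≤pred[n] z))))

  even-bound : double j ≤ double m → j < L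
  even-bound = s≤s ∘ double-cancel-≤

  odd-bound : suc (double j) ≤ double m → suc j < L
  odd-bound = s≤s ∘ odd<double⇒<

  nodeOf : Parity i → BCNode (suc L)
  nodeOf (even j) = inj₂ (edge j)
  nodeOf (odd j)  = inj₁ (clamp (suc j))

  pathNode : ℕ → BCNode (suc L)
  pathNode i = nodeOf (parity i)

  nodeOf-valid : (p : Parity i) → i ≤ double m → ValidNode H (nodeOf p)
  nodeOf-valid (even j) i≤2m = edge-isBlock (even-bound i≤2m)
  nodeOf-valid (odd j)  i≤2m = internal-isCutvertex (odd-bound i≤2m)

  nodeOf-injective : (p : Parity i) (p′ : Parity k) → i ≤ double m → k ≤ double m →
                     nodeOf p ≡ nodeOf p′ → i ≡ k
  nodeOf-injective (even j) (even j′) i≤2m k≤2m e =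
    cong double (edge-injective (even-bound i≤2m) (even-bound k≤2m) (inj₂-injective e))
  nodeOf-injective (odd j)  (odd j′)  i≤2m k≤2m e =
    cong (suc ∘ double) (suc-injective
      (clamp-injective (<⇒≤ (odd-bound i≤2m)) (<⇒≤ (odd-bound k≤2m)) (inj₁-injective e)))

  nodeOf-adj : (p : Parity i) → BCAdj (nodeOf p) (nodeOf (parity-suc p))
  nodeOf-adj (even j) = y∈pair
  nodeOf-adj (odd j)  = x∈pair {y = clamp (suc (suc j))}

  nodeOf-exact : (p : Parity i) (p′ : Parity k) → i ≤ double m → k ≤ double m →
                 BCAdj (nodeOf p) (nodeOf p′) → k ≡ suc i ⊎ i ≡ suc k
  nodeOf-exact (even j) (odd j′) i≤2m k≤2m adj with ∈pair⁻ adj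
  ... | inj₁ e = inj₂ (cong double (sym (clamp-injective (<⇒≤ (odd-bound k≤2m)) (<⇒≤ (even-bound i≤2m)) e)))
  ... | inj₂ e =
    inj₁ (cong (suc ∘ double) (suc-injective (clamp-injective (<⇒≤ (odd-bound k≤2m)) (even-bound i≤2m) e)))
  nodeOf-exact (odd j) (even j′) i≤2m k≤2m adj with ∈pair⁻ adj
  ... | inj₁ e = inj₁ (cong double (sym (clamp-injective (<⇒≤ (odd-bound i≤2m)) (<⇒≤ (even-bound k≤2m)) e)))
  ... | inj₂ e =
    inj₂ (cong (suc ∘ double) (suc-injective (clamp-injective (<⇒≤ (odd-bound i≤2m)) (even-bound k≤2m) e)))

  pathNode-onto : ∀ {x} → ValidNode H x → ∃[ i ] i ≤ double m × pathNode i ≡ x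
  pathNode-onto {inj₁ v} v-cut with cutvertex-internal v-cut
  ... | j , j+1<L , v≡ = suc (double j) , ≤-trans (n≤1+n _) (double-mono-≤ (≤-pred j+1<L)) ,
                         trans (cong nodeOf (parity-odd j)) (cong inj₁ (sym v≡))
  pathNode-onto {inj₂ B} B-block with block⇒edge B-block
  ... | j , j<L , B≡ = double j , double-mono-≤ (≤-pred j<L) ,
                       trans (cong nodeOf (parity-even j)) (cong inj₂ (sym B≡))

  pathBCPath : BCPath H (suc (double m))
  pathBCPath = record
    { node     = pathNode ∘ toℕ
    ; valid    = λ i → nodeOf-valid (parity (toℕ i)) (Fin.toℕ≤pred[n] i)
    ; distinct = λ i j → Fin.toℕ-injective ∘
                   nodeOf-injective (parity _) (parity _) (Fin.toℕ≤pred[n] i) (Fin.toℕ≤pred[n] j)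
    ; consec   = λ i j j≡1+i →
                   subst (BCAdj (pathNode (toℕ i)) ∘ pathNode) (sym j≡1+i) (nodeOf-adj (parity (toℕ i)))
    }

  pathGraph-chain : ChainOfBlocks H L
  pathGraph-chain = suc (double m) , pathBCPath , spans , exact , countBlocks-alternating pathBCPath refl
    where
      spans : ∀ x → ValidNode H x → ∃[ i ] node pathBCPath i ≡ x
      spans x x-valid with pathNode-onto x-valid
      ... | i , i≤2m , e = fromℕ< (s≤s i≤2m) , trans (cong pathNode (Fin.toℕ-fromℕ< (s≤s i≤2m))) e
      exact : ∀ i j → BCAdj (node pathBCPath i) (node pathBCPath j) →
              toℕ j ≡ suc (toℕ i) ⊎ toℕ i ≡ suc (toℕ j)
      exact i j = nodeOf-exact (parity (toℕ i)) (parity (toℕ j)) (Fin.toℕ≤pred[n] i) (Fin.toℕ≤pred[n] j)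

pathGraph-isChain : ∀ {L} → 1 ≤ L → ChainOfBlocks (pathGraph (suc L)) L
pathGraph-isChain {suc m} _ = PathGraph.pathGraph-chain m

lemma2p4 : (t : ℕ) → t ≥ 1 → ∃[ f ] ((n : ℕ) (G : Graph n) → BCPath G f →
    ∃[ k ] Σ (Graph k) λ H → InducedSubgraph H G × (∃[ m ] (m ≥ t × ChainOfBlocks H m)))
lemma2p4 t t≥1 = suc (suc (double t)) , induced-chain
  where
    induced-chain : (n : ℕ) (G : Graph n) → BCPath G (suc (suc (double t))) →
      ∃[ k ] Σ (Graph k) λ H → InducedSubgraph H G × (∃[ m ] (m ≥ t × ChainOfBlocks H m))
    induced-chain n G P with long-induced-path (bcPath⇒blockSequence P)
    ... | q , q-induced , t≤ℓ =
      _ , pathGraph _ , Walks.induced⇒pathGraph-embedding G q q-induced ,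
      _ , t≤ℓ , pathGraph-isChain (≤-trans t≥1 t≤ℓ)
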